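{- Let $G$ be a connected simple undirected graph on the node set $\{0,1,\dots,n\}$ with $n\ge 1$, and let $\nabla_G\subset\mathbb{R}^n$ be its adjacency polytope. Then for every facet $F$ of $\nabla_G$, the facet subnetwork $G_F=(\mathcal{V}_F,\mathcal{E}_F)$ has the following properties: (i) $G_F$ is acyclic (contains no directed cycle); (ii) $G_F$ contains all the nodes, i.e. $\mathcal{V}_F=\{0,1,\dots,n\}$; (iii) $G_F$ is weakly connected; (iv) any two directed paths in $G_F$ with the same starting node and the same end node have the same length; (v) if a directed path of $G_F$ of length $m$ consists of edges of a cycle of $G$ of length $\ell$, then $m\le \ell/2$ (each path in $G_F$ contains no more than half of the edges of any cycle in $G$ containing it); (vi) the transpose of $G_F$ (the directed graph on the same nodes with all edge directions reversed) is also a facet subnetwork of $\nabla_G$, namely $G_{ -F}$, where $-F=\{ -\mathbf{x}:\mathbf{x}\in F\}$ is also a facet of $\nabla_G$.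
   Context: Let $\mathbf{e}_1,\dots,\mathbf{e}_n$ be the standard basis of $\mathbb{R}^n$ and set $\mathbf{e}_0=\mathbf{0}$. Each undirected edge $\{i,j\}$ of $G$ is regarded as the two directed edges $(i,j)$ and $(j,i)$; write $\mathcal{E}(G)$ for the set of these directed edges. The adjacency polytope of $G$ is $\nabla_G=\operatorname{conv}\{\mathbf{e}_i-\mathbf{e}_j : (i,j)\in\mathcal{E}(G)\}\subset\mathbb{R}^n$ (a centrally symmetric polytope). A facet is a face of $\nabla_G$ of dimension $n-1$. For a facet $F$, define $\mathcal{V}_F=\{i : \mathbf{e}_i-\mathbf{e}_j\in F \text{ or } \mathbf{e}_j-\mathbf{e}_i\in F \text{ for some } j\}$ and $\mathcal{E}_F=\{(i,j) : \mathbf{e}_i-\mathbf{e}_j\in F\}$ (directed edges); the facet subnetwork associated with $F$ is the directed graph $G_F=(\mathcal{V}_F,\mathcal{E}_F)$.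
   Formalization: The adjacency polytope lies in ℚ^n instead of $\mathbb{R}^n$, so its facets are cut out by inequalities with rational coefficients and their dimension is measured by affine independence over ℚ. -}

module Defs where

open import Data.Nat using (ℕ; zero; suc)
open import Data.Fin using (Fin; zero; suc) renaming (_≟_ to _≟ᶠ_)
open import Data.Bool using (Bool; true; false)
open import Data.Rational using (ℚ; 0ℚ; 1ℚ; _+_; _*_; _-_; -_; _≤_)
open import Data.Product using (Σ; _×_; _,_; ∃)
open import Data.Sum using (_⊎_)
open import Data.List using (List; []; _∷_; length)
open import Data.List.Membership.Propositional using (_∈_)
open import Relation.Nullary using (¬_; yes; no)
open import Relation.Binary.PropositionalEquality using (_≡_)
import Data.Nat
import Data.Product
import Data.List.Relation.Unary.Unique.Propositional

record SimpleGraph (N : ℕ) : Set where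
  field
    adj   : Fin N → Fin N → Bool
    sym   : ∀ i j → adj i j ≡ adj j i
    irrefl : ∀ i → adj i i ≡ false

Edge : ∀ {N} → SimpleGraph N → Fin N → Fin N → Set
Edge G i j = SimpleGraph.adj G i j ≡ true

data Walk {A : Set} (R : A → A → Set) : A → A → Set where
  []  : ∀ {u} → Walk R u u
  _∷_ : ∀ {u v w} → R u v → Walk R v w → Walk R u w

walkLength : ∀ {A} {R : A → A → Set} {u v} → Walk R u v → ℕ
walkLength []      = zero
walkLength (_ ∷ w) = suc (walkLength w)

verts : ∀ {A} {R : A → A → Set} {u v} → Walk R u v → List A
verts {u = u} []      = u ∷ []
verts {u = u} (_ ∷ w) = u ∷ verts w

edges : ∀ {A} {R : A → A → Set} {u v} → Walk R u v → List (A × A)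
edges []                       = []
edges {u = u} (_∷_ {v = v} _ w) = (u , v) ∷ edges w

tailL : ∀ {A : Set} → List A → List A
tailL []       = []
tailL (_ ∷ xs) = xs

SymClosure : ∀ {A : Set} → (A → A → Set) → A → A → Set
SymClosure R x y = R x y ⊎ R y x

Connected : ∀ {N} → SimpleGraph N → Set
Connected G = ∀ u v → Walk (Edge G) u v

sumF : ∀ {k} → (Fin k → ℚ) → ℚ
sumF {zero}  f = 0ℚ
sumF {suc k} f = f zero + sumF (λ i → f (suc i))

δ : ∀ {N} → Fin N → Fin N → ℚ
δ i j with i ≟ᶠ j
... | yes _ = 1ℚ
... | no  _ = 0ℚ

-- e_i - e_j ∈ ℚ^n, with e_0 = 0 (node 0 ↦ zero vector, node suc k ↦ e_(k+1))
vtx : ∀ {n} → Fin (suc n) → Fin (suc n) → Fin n → ℚ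
vtx i j k = δ i (suc k) - δ j (suc k)

dot : ∀ {n} → (Fin n → ℚ) → (Fin n → ℚ) → ℚ
dot c x = sumF (λ k → c k * x k)

AffIndep : ∀ {n k} → (Fin k → (Fin n → ℚ)) → Set
AffIndep {n} {k} q =
  (λ′ : Fin k → ℚ) → sumF λ′ ≡ 0ℚ →
  (∀ t → sumF (λ i → λ′ i * q i t) ≡ 0ℚ) → ∀ i → λ′ i ≡ 0ℚ

module _ {n : ℕ} (G : SimpleGraph (suc n)) where

  OnFace : (Fin n → ℚ) → ℚ → Fin (suc n) → Fin (suc n) → Set
  OnFace c d i j = Edge G i j × (dot c (vtx i j) ≡ d)

  Valid : (Fin n → ℚ) → ℚ → Set
  Valid c d = ∀ i j → Edge G i j → dot c (vtx i j) ≤ d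

  -- the face contains k affinely independent points (equivalently, k
  -- affinely independent vertices, as the face is the convex hull of them)
  HasAffIndep : (Fin n → ℚ) → ℚ → ℕ → Set
  HasAffIndep c d k =
    Σ (Fin k → Fin (suc n) × Fin (suc n)) λ f →
      (∀ t → OnFace c d (Data.Product.proj₁ (f t)) (Data.Product.proj₂ (f t)))
      × AffIndep (λ t → vtx (Data.Product.proj₁ (f t)) (Data.Product.proj₂ (f t)))

  -- F = ∇_G ∩ {c·x = d} is a facet: a face of (affine) dimension n - 1,
  -- i.e. its affine hull has exactly n affinely independent points.
  IsFacet : (Fin n → ℚ) → ℚ → Set
  IsFacet c d = Valid c d × HasAffIndep c d n × ¬ HasAffIndep c d (suc n)

  FacetEdge : (Fin n → ℚ) → ℚ → Fin (suc n) → Fin (suc n) → Set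
  FacetEdge = OnFace

  InFacetNodes : (Fin n → ℚ) → ℚ → Fin (suc n) → Set
  InFacetNodes c d i = ∃ λ j → FacetEdge c d i j ⊎ FacetEdge c d j i

  record Cycle : Set where
    field
      start  : Fin (suc n)
      walk   : Walk (Edge G) start start
      long   : 3 Data.Nat.≤ walkLength walk
      simple : Data.List.Relation.Unary.Unique.Propositional.Unique (tailL (verts walk))

  CycleEdge : Cycle → Fin (suc n) → Fin (suc n) → Set
  CycleEdge C a b = (a , b) ∈ edges (Cycle.walk C) ⊎ (b , a) ∈ edges (Cycle.walk C)

IsPath : ∀ {A : Set} {R : A → A → Set} {u v} → Walk R u v → Set
IsPath w = Data.List.Relation.Unary.Unique.Propositional.Unique (verts w)

{-# OPTIONS --safe #-}
-- Write c · (eᵢ − eⱼ) = h i − h j for the potential h = (0, c) on the nodes. Validity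
-- of c · x ≤ d says that h drops by at most d along every edge of G, and G_F consists
-- of the edges where it drops by exactly d. Here d > 0, since for d = 0 every edge
-- would lie on F, while the edge vectors of a connected graph span ℚⁿ. Hence h drops
-- by m·d along every walk of length m in G_F, giving (i) and (iv); comparing with the
-- two arcs of a cycle through both ends of a path gives (v). A cut of the nodes that
-- no edge of G_F crosses would give a nonzero vector orthogonal to the n linearly
-- independent vertices of F, so (iii) holds, and (ii) follows from it. Finally ∇_G is
-- centrally symmetric, and negating c reverses every edge, which is (vi).
module Submission where

open import Defs
open import Algebra.Bundles using (Ring)
open import Data.Bool using (Bool; true; false) renaming (_≟_ to _≟ᵇ_)
open import Data.Empty using (⊥; ⊥-elim)
open import Data.Fin using (Fin; zero; suc; punchIn; punchOut; _≟_)
open import Data.Fin.Properties using (any?; punchInᵢ≢i; punchIn-punchOut)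
open import Data.Nat using (ℕ; zero; suc; z≤n; s≤s; _≤_; _*_)
import Data.Nat as ℕ
import Data.Nat.Properties as ℕ
open import Data.Product using (Σ; ∃; _×_; _,_; proj₁; proj₂; map; map₂; swap)
open import Data.Sum using (_⊎_; inj₁; inj₂; map₁)
open import Data.List using (List; []; _∷_; cartesianProduct; allFin)
open import Data.List.Membership.Propositional using (_∈_)
open import Data.List.Membership.Propositional.Properties using (∈-cartesianProduct⁺; ∈-allFin)
open import Data.List.Relation.Unary.Any using (here; there)
open import Data.Rational using (ℚ; 0ℚ; 1ℚ; _+_; _-_; -_; 1/_)
  renaming (_*_ to _·_; _≤_ to _≤ℚ_; _<_ to _<ℚ_)
open import Data.Rational using () renaming (-_ to -ℚ_)
import Data.Rational as ℚ
import Data.Rational.Properties as ℚ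
open import Data.Rational.Solver using (module +-*-Solver)
open import Data.Nat.Induction using (<-rec; <-wellFounded)
open import Data.Vec.Functional using (insertAt)
open import Data.Vec.Functional.Properties using (insertAt-lookup; insertAt-punchIn)
open import Function using (id; _∘_; case_of_; _⇔_; mk⇔)
open import Induction.WellFounded using (module All)
import Relation.Binary.Construct.On as On
open import Relation.Binary.Definitions using (tri<; tri≈; tri>)
open import Relation.Binary.PropositionalEquality
open import Relation.Nullary using (Dec; does; yes; no; ¬?)
open import Relation.Nullary.Decidable using (_×-dec_; dec-true; dec-false)

open import Algebra.Properties.Semiring.Sum (Ring.semiring ℚ.+-*-ring)
  using (sum; ∑-distrib-+; ∑-comm; sum-remove; *-distribˡ-sum)
open import Algebra.Properties.Semiring.Mult (Ring.semiring ℚ.+-*-ring)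
  using (×-homo-+) renaming (_×_ to _×ℚ_)
open import Algebra.Properties.Ring ℚ.+-*-ring using (-1*x≈-x; -‿distribʳ-*; x∙y⁻¹≈ε⇒x≈y; x[y-z]≈xy-xz)
open +-*-Solver

sumF≡sum : ∀ {k} (f : Fin k → ℚ) → sumF f ≡ sum f
sumF≡sum {zero}  f = refl
sumF≡sum {suc k} f = cong (f zero +_) (sumF≡sum (f ∘ suc))

sumF-cong : ∀ {k} {f g : Fin k → ℚ} → (∀ i → f i ≡ g i) → sumF f ≡ sumF g
sumF-cong {zero}  f≗g = refl
sumF-cong {suc k} f≗g = cong₂ _+_ (f≗g zero) (sumF-cong (f≗g ∘ suc))

sumF-zero : ∀ {k} {f : Fin k → ℚ} → (∀ i → f i ≡ 0ℚ) → sumF f ≡ 0ℚ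
sumF-zero {zero}  f≗0 = refl
sumF-zero {suc k} f≗0 = cong₂ _+_ (f≗0 zero) (sumF-zero (f≗0 ∘ suc))

sumF-distrib-+ : ∀ {k} (f g : Fin k → ℚ) → sumF (λ i → f i + g i) ≡ sumF f + sumF g
sumF-distrib-+ f g = begin
  sumF (λ i → f i + g i) ≡⟨ sumF≡sum (λ i → f i + g i) ⟩
  sum (λ i → f i + g i)  ≡⟨ ∑-distrib-+ f g ⟩
  sum f + sum g          ≡⟨ sym (cong₂ _+_ (sumF≡sum f) (sumF≡sum g)) ⟩
  sumF f + sumF g        ∎
  where open ≡-Reasoning

*-distribˡ-sumF : ∀ {k} x (f : Fin k → ℚ) → x · sumF f ≡ sumF (λ i → x · f i)
*-distribˡ-sumF x f = begin
  x · sumF f            ≡⟨ cong (x ·_) (sumF≡sum f) ⟩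
  x · sum f             ≡⟨ *-distribˡ-sum x f ⟩
  sum (λ i → x · f i)   ≡⟨ sym (sumF≡sum (λ i → x · f i)) ⟩
  sumF (λ i → x · f i)  ∎
  where open ≡-Reasoning

sumF-comm : ∀ {m k} (M : Fin m → Fin k → ℚ) →
            sumF (λ i → sumF (M i)) ≡ sumF (λ j → sumF (λ i → M i j))
sumF-comm M = begin
  sumF (λ i → sumF (M i))           ≡⟨ sumF-cong (λ i → sumF≡sum (M i)) ⟩
  sumF (λ i → sum (M i))            ≡⟨ sumF≡sum (λ i → sum (M i)) ⟩
  sum (λ i → sum (M i))             ≡⟨ ∑-comm M ⟩
  sum (λ j → sum (λ i → M i j))     ≡⟨ sym (sumF≡sum (λ j → sum (λ i → M i j))) ⟩
  sumF (λ j → sum (λ i → M i j))    ≡⟨ sumF-cong (λ j → sym (sumF≡sum (λ i → M i j))) ⟩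
  sumF (λ j → sumF (λ i → M i j))   ∎
  where open ≡-Reasoning

sumF-remove : ∀ {k} (f : Fin (suc k) → ℚ) (p : Fin (suc k)) →
              sumF f ≡ f p + sumF (f ∘ punchIn p)
sumF-remove f p = begin
  sumF f                      ≡⟨ sumF≡sum f ⟩
  sum f                       ≡⟨ sum-remove f ⟩
  f p + sum (f ∘ punchIn p)   ≡⟨ cong (f p +_) (sym (sumF≡sum (f ∘ punchIn p))) ⟩
  f p + sumF (f ∘ punchIn p)  ∎
  where open ≡-Reasoning

sumF-neg : ∀ {k} (f : Fin k → ℚ) → sumF (λ i → - f i) ≡ - sumF f
sumF-neg f = begin
  sumF (λ i → - f i)          ≡⟨ sumF-cong (λ i → sym (-1*x≈-x (f i))) ⟩
  sumF (λ i → - 1ℚ · f i)     ≡⟨ sym (*-distribˡ-sumF (- 1ℚ) f) ⟩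
  - 1ℚ · sumF f               ≡⟨ -1*x≈-x (sumF f) ⟩
  - sumF f                    ∎
  where open ≡-Reasoning

sumF-distrib-- : ∀ {k} (f g : Fin k → ℚ) → sumF (λ i → f i - g i) ≡ sumF f - sumF g
sumF-distrib-- f g = trans (sumF-distrib-+ f (λ i → - g i)) (cong (sumF f +_) (sumF-neg g))

δ-refl : ∀ {N} (i : Fin N) → δ i i ≡ 1ℚ
δ-refl i with i ≟ i
... | yes _  = refl
... | no i≢i = ⊥-elim (i≢i refl)

δ-≢ : ∀ {N} {i j : Fin N} → i ≢ j → δ i j ≡ 0ℚ
δ-≢ {i = i} {j} i≢j with i ≟ j
... | yes i≡j = ⊥-elim (i≢j i≡j)
... | no _    = refl

δ-sym : ∀ {N} (i j : Fin N) → δ i j ≡ δ j i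
δ-sym i j with i ≟ j
... | yes refl = sym (δ-refl i)
... | no i≢j   = sym (δ-≢ (i≢j ∘ sym))

δ-suc : ∀ {N} (i j : Fin N) → δ (suc i) (suc j) ≡ δ i j
δ-suc i j with i ≟ j
... | yes refl = refl
... | no i≢j   = refl

sumF-select : ∀ {k} (f : Fin k → ℚ) (i : Fin k) → sumF (λ j → f j · δ i j) ≡ f i
sumF-select {suc k} f i = begin
  sumF (λ j → f j · δ i j)                                        ≡⟨ sumF-remove (λ j → f j · δ i j) i ⟩
  f i · δ i i + sumF (λ t → f (punchIn i t) · δ i (punchIn i t))  ≡⟨ cong₂ _+_ (cong (f i ·_) (δ-refl i)) (sumF-zero off-diagonal) ⟩
  f i · 1ℚ + 0ℚ                                                   ≡⟨ solve 1 (λ x → x :* con 1ℚ :+ con 0ℚ := x) refl (f i) ⟩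
  f i                                                             ∎
  where
  open ≡-Reasoning
  off-diagonal : ∀ t → f (punchIn i t) · δ i (punchIn i t) ≡ 0ℚ
  off-diagonal t = trans (cong (f (punchIn i t) ·_) (δ-≢ (punchInᵢ≢i i t ∘ sym))) (ℚ.*-zeroʳ (f (punchIn i t)))

-- potential c i = c · eᵢ, where e₀ = 0.
potential : ∀ {n} → (Fin n → ℚ) → Fin (suc n) → ℚ
potential c zero    = 0ℚ
potential c (suc k) = c k

dot-δ : ∀ {n} (c : Fin n → ℚ) (i : Fin (suc n)) → sumF (λ k → c k · δ i (suc k)) ≡ potential c i
dot-δ c zero    = sumF-zero (λ k → trans (cong (c k ·_) (δ-≢ {i = zero} {suc k} λ ())) (ℚ.*-zeroʳ (c k)))
dot-δ c (suc i) = trans (sumF-cong (λ k → cong (c k ·_) (δ-suc i k))) (sumF-select c i)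

dot-vtx : ∀ {n} (c : Fin n → ℚ) (i j : Fin (suc n)) → dot c (vtx i j) ≡ potential c i - potential c j
dot-vtx c i j = begin
  sumF (λ k → c k · (δ i (suc k) - δ j (suc k)))                   ≡⟨ sumF-cong (λ k → x[y-z]≈xy-xz (c k) _ _) ⟩
  sumF (λ k → c k · δ i (suc k) - c k · δ j (suc k))               ≡⟨ sumF-distrib-- (λ k → c k · δ i (suc k)) (λ k → c k · δ j (suc k)) ⟩
  sumF (λ k → c k · δ i (suc k)) - sumF (λ k → c k · δ j (suc k))  ≡⟨ cong₂ _-_ (dot-δ c i) (dot-δ c j) ⟩
  potential c i - potential c j                                    ∎
  where open ≡-Reasoning

vtx-swap : ∀ {n} (i j : Fin (suc n)) k → vtx j i k ≡ - vtx i j k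
vtx-swap i j k = solve 2 (λ a b → b :- a := :- (a :- b)) refl (δ i (suc k)) (δ j (suc k))

dot-vtx-swap : ∀ {n} (c : Fin n → ℚ) (i j : Fin (suc n)) → dot c (vtx j i) ≡ - dot c (vtx i j)
dot-vtx-swap c i j = begin
  dot c (vtx j i)                    ≡⟨ dot-vtx c j i ⟩
  potential c j - potential c i      ≡⟨ solve 2 (λ x y → y :- x := :- (x :- y)) refl (potential c i) (potential c j) ⟩
  - (potential c i - potential c j)  ≡⟨ cong -_ (sym (dot-vtx c i j)) ⟩
  - dot c (vtx i j)                  ∎
  where open ≡-Reasoning

dot-neg-vtx : ∀ {n} (c : Fin n → ℚ) (i j : Fin (suc n)) → dot (λ k → - c k) (vtx i j) ≡ dot c (vtx j i)
dot-neg-vtx c i j = begin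
  dot (λ k → - c k) (vtx i j)                            ≡⟨ dot-vtx (λ k → - c k) i j ⟩
  potential (λ k → - c k) i - potential (λ k → - c k) j  ≡⟨ cong₂ _-_ (potential-neg i) (potential-neg j) ⟩
  - potential c i - - potential c j                      ≡⟨ solve 2 (λ a b → :- a :- :- b := b :- a) refl (potential c i) (potential c j) ⟩
  potential c j - potential c i                          ≡⟨ sym (dot-vtx c j i) ⟩
  dot c (vtx j i)                                        ∎
  where
  open ≡-Reasoning
  potential-neg : ∀ i → potential (λ k → - c k) i ≡ - potential c i
  potential-neg zero    = refl
  potential-neg (suc k) = refl

lincomb : ∀ {m k} → (Fin m → ℚ) → (Fin m → Fin k → ℚ) → Fin k → ℚ
lincomb μ v j = sumF (λ t → μ t · v t j)

LinIndep : ∀ {m k} → (Fin m → Fin k → ℚ) → Set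
LinIndep v = ∀ μ → (∀ j → lincomb μ v j ≡ 0ℚ) → ∀ t → μ t ≡ 0ℚ

Dependent : ∀ {m k} → (Fin m → Fin k → ℚ) → Set
Dependent {m} v = Σ (Fin m → ℚ) λ μ → (∃ λ t → μ t ≢ 0ℚ) × (∀ j → lincomb μ v j ≡ 0ℚ)

dot-lincomb : ∀ {m k} (g : Fin k → ℚ) (μ : Fin m → ℚ) (v : Fin m → Fin k → ℚ) →
              dot g (lincomb μ v) ≡ sumF (λ t → μ t · dot g (v t))
dot-lincomb g μ v = begin
  sumF (λ j → g j · sumF (λ t → μ t · v t j))      ≡⟨ sumF-cong (λ j → *-distribˡ-sumF (g j) (λ t → μ t · v t j)) ⟩
  sumF (λ j → sumF (λ t → g j · (μ t · v t j)))    ≡⟨ sumF-comm (λ j t → g j · (μ t · v t j)) ⟩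
  sumF (λ t → sumF (λ j → g j · (μ t · v t j)))    ≡⟨ sumF-cong (λ t → sumF-cong (λ j → exchange (g j) (μ t) (v t j))) ⟩
  sumF (λ t → sumF (λ j → μ t · (g j · v t j)))    ≡⟨ sumF-cong (λ t → sym (*-distribˡ-sumF (μ t) (λ j → g j · v t j))) ⟩
  sumF (λ t → μ t · sumF (λ j → g j · v t j))      ∎
  where
  open ≡-Reasoning
  exchange : ∀ a b x → a · (b · x) ≡ b · (a · x)
  exchange = solve 3 (λ a b x → a :* (b :* x) := b :* (a :* x)) refl

x·y≡0⇒y≡0 : ∀ {x y} → x ≢ 0ℚ → x · y ≡ 0ℚ → y ≡ 0ℚ
x·y≡0⇒y≡0 {x} {y} x≢0 xy≡0 = begin
  y               ≡⟨ sym (ℚ.*-identityˡ y) ⟩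
  1ℚ · y          ≡⟨ cong (_· y) (sym (ℚ.*-inverseˡ x)) ⟩
  1/ x · x · y    ≡⟨ ℚ.*-assoc (1/ x) x y ⟩
  1/ x · (x · y)  ≡⟨ cong (1/ x ·_) xy≡0 ⟩
  1/ x · 0ℚ       ≡⟨ ℚ.*-zeroʳ (1/ x) ⟩
  0ℚ              ∎
  where
  open ≡-Reasoning
  instance
    x-nonZero : ℚ.NonZero x
    x-nonZero = ℚ.≢-nonZero x≢0

-- One step of Gaussian elimination: the vectors other than the pivot p have
-- their first coordinate cleared by subtracting β-multiples of v p, and a
-- dependence μ′ of what remains lifts to a dependence of the original vectors.
eliminate : ∀ {m k} (v : Fin (suc m) → Fin (suc k) → ℚ) (p : Fin (suc m)) (β : Fin m → ℚ) →
            (∀ t → v (punchIn p t) zero - β t · v p zero ≡ 0ℚ) →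
            Dependent (λ t j → v (punchIn p t) (suc j) - β t · v p (suc j)) →
            Dependent v
eliminate v p β cleared (μ′ , (t , μ′t≢0) , μ′-kills) = μ , (punchIn p t , μ-nonzero) , μ-kills
  where
  S = sumF (λ t → μ′ t · β t)
  μ = insertAt μ′ p (- S)
  μ-nonzero : μ (punchIn p t) ≢ 0ℚ
  μ-nonzero = μ′t≢0 ∘ trans (sym (insertAt-punchIn μ′ p (- S) t))
  reduced : ∀ j → lincomb μ′ (λ t j → v (punchIn p t) j - β t · v p j) j ≡ 0ℚ
  reduced zero    = sumF-zero (λ t → trans (cong (μ′ t ·_) (cleared t)) (ℚ.*-zeroʳ (μ′ t)))
  reduced (suc j) = μ′-kills j
  others : ∀ j → lincomb μ′ (v ∘ punchIn p) j ≡ S · v p j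
  others j = begin
    sumF (λ t → μ′ t · v (punchIn p t) j)
      ≡⟨ sumF-cong (λ t → regroup (μ′ t) (v (punchIn p t) j) (β t) (v p j)) ⟩
    sumF (λ t → μ′ t · (v (punchIn p t) j - β t · v p j) + μ′ t · β t · v p j)
      ≡⟨ sumF-distrib-+ _ (λ t → μ′ t · β t · v p j) ⟩
    lincomb μ′ (λ t j → v (punchIn p t) j - β t · v p j) j + sumF (λ t → μ′ t · β t · v p j)
      ≡⟨ cong₂ _+_ (reduced j) (sumF-cong (λ t → ℚ.*-comm (μ′ t · β t) (v p j))) ⟩
    0ℚ + sumF (λ t → v p j · (μ′ t · β t))
      ≡⟨ trans (ℚ.+-identityˡ _) (sym (*-distribˡ-sumF (v p j) (λ t → μ′ t · β t))) ⟩
    v p j · S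
      ≡⟨ ℚ.*-comm (v p j) S ⟩
    S · v p j ∎
    where
    open ≡-Reasoning
    regroup : ∀ a x b y → a · x ≡ a · (x - b · y) + a · b · y
    regroup = solve 4 (λ a x b y → a :* x := a :* (x :- b :* y) :+ a :* b :* y) refl
  μ-kills : ∀ j → lincomb μ v j ≡ 0ℚ
  μ-kills j = begin
    lincomb μ v j
      ≡⟨ sumF-remove (λ t → μ t · v t j) p ⟩
    μ p · v p j + lincomb (μ ∘ punchIn p) v′ j
      ≡⟨ cong₂ _+_ (cong (_· v p j) (insertAt-lookup μ′ p (- S)))
                   (sumF-cong (λ t → cong (_· v′ t j) (insertAt-punchIn μ′ p (- S) t))) ⟩
    - S · v p j + lincomb μ′ v′ j
      ≡⟨ cong (- S · v p j +_) (others j) ⟩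
    - S · v p j + S · v p j
      ≡⟨ solve 2 (λ s x → :- s :* x :+ s :* x := con 0ℚ) refl S (v p j) ⟩
    0ℚ ∎
    where
    open ≡-Reasoning
    v′ = v ∘ punchIn p

dependent : ∀ r (v : Fin (suc r) → Fin r → ℚ) → Dependent v
dependent zero    v = (λ _ → 1ℚ) , (zero , λ ()) , λ ()
dependent (suc r) v with any? (λ t → ¬? (v t zero ℚ.≟ 0ℚ))
... | yes (p , vp0≢0) = eliminate v p β cleared (dependent r (λ t j → v (punchIn p t) (suc j) - β t · v p (suc j)))
  where
  instance
    pivot-nonZero : ℚ.NonZero (v p zero)
    pivot-nonZero = ℚ.≢-nonZero vp0≢0
  β : Fin (suc r) → ℚ
  β t = v (punchIn p t) zero · 1/ v p zero
  cleared : ∀ t → v (punchIn p t) zero - β t · v p zero ≡ 0ℚ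
  cleared t = begin
    a - a · 1/ v p zero · v p zero    ≡⟨ cong (λ x → a - x) (ℚ.*-assoc a (1/ v p zero) (v p zero)) ⟩
    a - a · (1/ v p zero · v p zero)  ≡⟨ cong (λ x → a - a · x) (ℚ.*-inverseˡ (v p zero)) ⟩
    a - a · 1ℚ                        ≡⟨ solve 1 (λ a → a :- a :* con 1ℚ := con 0ℚ) refl a ⟩
    0ℚ                                ∎
    where
    open ≡-Reasoning
    a = v (punchIn p t) zero
... | no none = eliminate v zero (λ _ → 0ℚ) cleared (dependent r (λ t j → v (suc t) (suc j) - 0ℚ · v zero (suc j)))
  where
  cleared : ∀ t → v (suc t) zero - 0ℚ · v zero zero ≡ 0ℚ
  cleared t with v (suc t) zero ℚ.≟ 0ℚ
  ... | yes vt0≡0 = trans (cong₂ _-_ vt0≡0 (ℚ.*-zeroˡ (v zero zero))) (ℚ.+-inverseʳ 0ℚ)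
  ... | no vt0≢0  = ⊥-elim (none (suc t , vt0≢0))

-- Dropping the coordinate k leaves n vectors in ℚⁿ⁻¹; their dependence μ gives
-- a combination w = Σ μ v supported on k, and g · w = 0 forces w = 0.
orthogonal-to-independent⇒zero : ∀ {n} (v : Fin n → Fin n → ℚ) → LinIndep v →
                                 ∀ g → (∀ t → dot g (v t) ≡ 0ℚ) → ∀ k → g k ≡ 0ℚ
orthogonal-to-independent⇒zero {suc r} v indep g g⊥v k with g k ℚ.≟ 0ℚ
... | yes gk≡0 = gk≡0
... | no gk≢0 with dependent r (λ t j → v t (punchIn k j))
...   | μ , (t , μt≢0) , w-off = ⊥-elim (μt≢0 (indep μ w≡0 t))
  where
  open ≡-Reasoning
  w = lincomb μ v
  wk≡0 : w k ≡ 0ℚ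
  wk≡0 = x·y≡0⇒y≡0 gk≢0 (begin
    g k · w k                                                     ≡⟨ sym (ℚ.+-identityʳ (g k · w k)) ⟩
    g k · w k + 0ℚ                                                ≡⟨ cong (g k · w k +_) (sym (sumF-zero off-k)) ⟩
    g k · w k + sumF (λ j → g (punchIn k j) · w (punchIn k j))    ≡⟨ sym (sumF-remove (λ j → g j · w j) k) ⟩
    dot g w                                                       ≡⟨ dot-lincomb g μ v ⟩
    sumF (λ t → μ t · dot g (v t))                                ≡⟨ sumF-zero (λ t → trans (cong (μ t ·_) (g⊥v t)) (ℚ.*-zeroʳ (μ t))) ⟩
    0ℚ                                                            ∎)
    where
    off-k : ∀ j → g (punchIn k j) · w (punchIn k j) ≡ 0ℚ
    off-k j = trans (cong (g (punchIn k j) ·_) (w-off j)) (ℚ.*-zeroʳ (g (punchIn k j)))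
  w≡0 : ∀ j → w j ≡ 0ℚ
  w≡0 j with k ≟ j
  ... | yes refl = wk≡0
  ... | no k≢j   = subst (λ i → w i ≡ 0ℚ) (punchIn-punchOut k≢j) (w-off (punchOut k≢j))

-- d · Σ μ = c · (Σ μ q) = 0, so for d ≠ 0 every linear relation is an affine one.
affIndep⇒linIndep : ∀ {m k} (q : Fin m → Fin k → ℚ) (c : Fin k → ℚ) (d : ℚ) → d ≢ 0ℚ →
                    (∀ t → dot c (q t) ≡ d) → AffIndep q → LinIndep q
affIndep⇒linIndep q c d d≢0 on-hyperplane aff μ μq≡0 = aff μ Σμ≡0 μq≡0
  where
  open ≡-Reasoning
  Σμ≡0 : sumF μ ≡ 0ℚ
  Σμ≡0 = x·y≡0⇒y≡0 d≢0 (begin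
    d · sumF μ                       ≡⟨ *-distribˡ-sumF d μ ⟩
    sumF (λ t → d · μ t)             ≡⟨ sumF-cong (λ t → trans (ℚ.*-comm d (μ t)) (cong (μ t ·_) (sym (on-hyperplane t)))) ⟩
    sumF (λ t → μ t · dot c (q t))   ≡⟨ sym (dot-lincomb c μ q) ⟩
    dot c (lincomb μ q)              ≡⟨ sumF-zero (λ j → trans (cong (c j ·_) (μq≡0 j)) (ℚ.*-zeroʳ (c j))) ⟩
    0ℚ                               ∎)

negated-head-affIndep : ∀ {m k} (q : Fin (suc (suc m)) → Fin k → ℚ) →
                        (∀ j → q zero j ≡ - q (suc zero) j) → LinIndep (q ∘ suc) → AffIndep q
negated-head-affIndep q q₀≡-q₁ indep l Σl≡0 lq≡0 = l≡0
  where
  open ≡-Reasoning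
  μ : Fin _ → ℚ
  μ zero    = l (suc zero) - l zero
  μ (suc t) = l (suc (suc t))
  μq≡0 : ∀ j → lincomb μ (q ∘ suc) j ≡ 0ℚ
  μq≡0 j = begin
    (l₁ - l₀) · q (suc zero) j + rest
      ≡⟨ solve 4 (λ l₀ l₁ a r → (l₁ :- l₀) :* a :+ r := l₀ :* (:- a) :+ (l₁ :* a :+ r)) refl l₀ l₁ (q (suc zero) j) rest ⟩
    l₀ · - q (suc zero) j + (l₁ · q (suc zero) j + rest)
      ≡⟨ cong (λ x → l₀ · x + (l₁ · q (suc zero) j + rest)) (sym (q₀≡-q₁ j)) ⟩
    lincomb l q j
      ≡⟨ lq≡0 j ⟩
    0ℚ ∎
    where
    l₀ = l zero
    l₁ = l (suc zero)
    rest = sumF (λ t → l (suc (suc t)) · q (suc (suc t)) j)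
  μ≡0 = indep μ μq≡0
  l₁≡l₀ : l (suc zero) ≡ l zero
  l₁≡l₀ = x∙y⁻¹≈ε⇒x≈y (l (suc zero)) (l zero) (μ≡0 zero)
  l₀≡0 : l zero ≡ 0ℚ
  l₀≡0 = x·y≡0⇒y≡0 {1ℚ + 1ℚ} (λ ()) (begin
    (1ℚ + 1ℚ) · l zero
      ≡⟨ solve 1 (λ x → (con 1ℚ :+ con 1ℚ) :* x := x :+ (x :+ con 0ℚ)) refl (l zero) ⟩
    l zero + (l zero + 0ℚ)
      ≡⟨ cong₂ (λ a b → l zero + (a + b)) (sym l₁≡l₀) (sym (sumF-zero {f = λ t → l (suc (suc t))} (μ≡0 ∘ suc))) ⟩
    l zero + (l (suc zero) + sumF (λ t → l (suc (suc t))))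
      ≡⟨ Σl≡0 ⟩
    0ℚ ∎)
  l≡0 : ∀ i → l i ≡ 0ℚ
  l≡0 zero          = l₀≡0
  l≡0 (suc zero)    = trans l₁≡l₀ l₀≡0
  l≡0 (suc (suc t)) = μ≡0 (suc t)

affIndep-neg : ∀ {m k} {q q′ : Fin m → Fin k → ℚ} → (∀ t j → q′ t j ≡ - q t j) → AffIndep q → AffIndep q′
affIndep-neg {q = q} {q′} q′≡-q aff l Σl≡0 lq′≡0 = aff l Σl≡0 lq≡0
  where
  lq≡0 : ∀ j → lincomb l q j ≡ 0ℚ
  lq≡0 j = ℚ.neg-injective (begin
    - lincomb l q j                ≡⟨ sym (sumF-neg (λ t → l t · q t j)) ⟩
    sumF (λ t → - (l t · q t j))   ≡⟨ sumF-cong (λ t → trans (-‿distribʳ-* (l t) (q t j)) (cong (l t ·_) (sym (q′≡-q t j)))) ⟩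
    lincomb l q′ j                 ≡⟨ lq′≡0 j ⟩
    0ℚ                             ∎)
    where open ≡-Reasoning

+-cancelˡ-≤ℚ : ∀ a {x y} → a + x ≤ℚ a + y → x ≤ℚ y
+-cancelˡ-≤ℚ a {x} {y} a+x≤a+y = subst₂ _≤ℚ_ (cancel x) (cancel y) (ℚ.+-monoʳ-≤ (- a) a+x≤a+y)
  where
  cancel : ∀ z → - a + (a + z) ≡ z
  cancel = solve 2 (λ a z → :- a :+ (a :+ z) := z) refl a

×ℚ-nonNeg : ∀ m {d} → 0ℚ ≤ℚ d → 0ℚ ≤ℚ m ×ℚ d
×ℚ-nonNeg zero    0≤d = ℚ.≤-refl
×ℚ-nonNeg (suc m) 0≤d = ℚ.+-mono-≤ 0≤d (×ℚ-nonNeg m 0≤d)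

×ℚ-cancelʳ-≤ : ∀ m n {d} → 0ℚ <ℚ d → m ×ℚ d ≤ℚ n ×ℚ d → m ≤ n
×ℚ-cancelʳ-≤ zero    n       0<d _      = z≤n
×ℚ-cancelʳ-≤ (suc m) zero    0<d m×d≤0 =
  ⊥-elim (ℚ.<-irrefl refl (ℚ.<-≤-trans (ℚ.+-mono-<-≤ 0<d (×ℚ-nonNeg m (ℚ.<⇒≤ 0<d))) m×d≤0))
×ℚ-cancelʳ-≤ (suc m) (suc n) {d} 0<d le = s≤s (×ℚ-cancelʳ-≤ m n 0<d (+-cancelˡ-≤ℚ d le))

module _ {A : Set} {R : A → A → Set} where

  _++ʷ_ : ∀ {a b c} → Walk R a b → Walk R b c → Walk R a c
  []      ++ʷ q = q
  (e ∷ p) ++ʷ q = e ∷ (p ++ʷ q)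

  length-++ : ∀ {a b c} (p : Walk R a b) (q : Walk R b c) →
              walkLength (p ++ʷ q) ≡ walkLength p ℕ.+ walkLength q
  length-++ []      q = refl
  length-++ (e ∷ p) q = cong suc (length-++ p q)

  reverse : (∀ {x y} → R x y → R y x) → ∀ {a b} → Walk R a b → Walk R b a
  reverse R-sym []      = []
  reverse R-sym (e ∷ w) = reverse R-sym w ++ʷ (R-sym e ∷ [])

  length-reverse : (R-sym : ∀ {x y} → R x y → R y x) → ∀ {a b} (w : Walk R a b) →
                   walkLength (reverse R-sym w) ≡ walkLength w
  length-reverse R-sym []      = refl
  length-reverse R-sym (e ∷ w) = begin
    walkLength (reverse R-sym w ++ʷ (R-sym e ∷ []))  ≡⟨ length-++ (reverse R-sym w) (R-sym e ∷ []) ⟩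
    walkLength (reverse R-sym w) ℕ.+ 1               ≡⟨ cong (ℕ._+ 1) (length-reverse R-sym w) ⟩
    walkLength w ℕ.+ 1                               ≡⟨ ℕ.+-comm (walkLength w) 1 ⟩
    suc (walkLength w)                               ∎
    where open ≡-Reasoning

  first-step : ∀ {a b} → Walk R a b → a ≢ b → ∃ λ x → R a x
  first-step []      a≢a = ⊥-elim (a≢a refl)
  first-step (e ∷ w) _   = _ , e

  head∈verts : ∀ {a b} (w : Walk R a b) → a ∈ verts w
  head∈verts []      = here refl
  head∈verts (e ∷ w) = here refl

  edge∈⇒verts∈ : ∀ {a b x y} (w : Walk R a b) → (x , y) ∈ edges w → x ∈ verts w × y ∈ verts w
  edge∈⇒verts∈ (e ∷ w) (here refl) = here refl , there (head∈verts w)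
  edge∈⇒verts∈ (e ∷ w) (there xy∈w) = map there there (edge∈⇒verts∈ w xy∈w)

  last-edge : ∀ {a b c} (e : R a b) (w : Walk R b c) → ∃ λ x → (x , c) ∈ edges (e ∷ w)
  last-edge e []       = _ , here refl
  last-edge e (e′ ∷ w) = map₂ there (last-edge e′ w)

  split : ∀ {a b x} (w : Walk R a b) → x ∈ verts w →
          Σ (Walk R a x) λ P → Σ (Walk R x b) λ Q →
            (walkLength P ℕ.+ walkLength Q ≡ walkLength w) × (∀ {z} → z ∈ verts w → z ∈ verts P ⊎ z ∈ verts Q)
  split []      (here refl) = [] , [] , refl , inj₁
  split (e ∷ w) (here refl) = [] , e ∷ w , refl , inj₂
  split (e ∷ w) (there x∈w) with split w x∈w
  ... | P , Q , |P|+|Q| , partition = e ∷ P , Q , cong suc |P|+|Q| , partition′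
    where
    partition′ : ∀ {z} → z ∈ verts (e ∷ w) → z ∈ verts (e ∷ P) ⊎ z ∈ verts Q
    partition′ (here refl) = inj₁ (here refl)
    partition′ (there z∈w) = map₁ there (partition z∈w)

  closedWalk-arcs : ∀ {s x y} (W : Walk R s s) → x ∈ verts W → y ∈ verts W →
                    Σ (Walk R x y) λ A → Σ (Walk R y x) λ B → walkLength A ℕ.+ walkLength B ≡ walkLength W
  closedWalk-arcs W x∈W y∈W with split W x∈W
  ... | P , Q , |P|+|Q| , partition with partition y∈W
  ...   | inj₂ y∈Q with split Q y∈Q
  ...     | Q₁ , Q₂ , |Q₁|+|Q₂| , _ = Q₁ , Q₂ ++ʷ P , (begin
    walkLength Q₁ ℕ.+ walkLength (Q₂ ++ʷ P)              ≡⟨ cong (walkLength Q₁ ℕ.+_) (length-++ Q₂ P) ⟩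
    walkLength Q₁ ℕ.+ (walkLength Q₂ ℕ.+ walkLength P)   ≡⟨ sym (ℕ.+-assoc (walkLength Q₁) _ _) ⟩
    walkLength Q₁ ℕ.+ walkLength Q₂ ℕ.+ walkLength P     ≡⟨ cong (ℕ._+ walkLength P) |Q₁|+|Q₂| ⟩
    walkLength Q ℕ.+ walkLength P                        ≡⟨ ℕ.+-comm (walkLength Q) (walkLength P) ⟩
    walkLength P ℕ.+ walkLength Q                        ≡⟨ |P|+|Q| ⟩
    walkLength W                                         ∎)
    where open ≡-Reasoning
  closedWalk-arcs W x∈W y∈W | P , Q , |P|+|Q| , _ | inj₁ y∈P with split P y∈P
  ...     | P₁ , P₂ , |P₁|+|P₂| , _ = Q ++ʷ P₁ , P₂ , (begin
    walkLength (Q ++ʷ P₁) ℕ.+ walkLength P₂              ≡⟨ cong (ℕ._+ walkLength P₂) (length-++ Q P₁) ⟩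
    walkLength Q ℕ.+ walkLength P₁ ℕ.+ walkLength P₂     ≡⟨ ℕ.+-assoc (walkLength Q) _ _ ⟩
    walkLength Q ℕ.+ (walkLength P₁ ℕ.+ walkLength P₂)   ≡⟨ cong (walkLength Q ℕ.+_) |P₁|+|P₂| ⟩
    walkLength Q ℕ.+ walkLength P                        ≡⟨ ℕ.+-comm (walkLength Q) (walkLength P) ⟩
    walkLength P ℕ.+ walkLength Q                        ≡⟨ |P|+|Q| ⟩
    walkLength W                                         ∎)
    where open ≡-Reasoning

edge-sym : ∀ {N} (G : SimpleGraph N) {a b} → Edge G a b → Edge G b a
edge-sym G {a} {b} e = trans (SimpleGraph.sym G b a) e

edge? : ∀ {N} (G : SimpleGraph N) a b → Dec (Edge G a b)
edge? G a b = SimpleGraph.adj G a b ≟ᵇ true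

relabel : ∀ {N} → Fin N → Fin N → Fin N → Fin N
relabel p q z with z ≟ q
... | yes _ = p
... | no _  = z

relabel-target : ∀ {N} (p q : Fin N) → relabel p q q ≡ p
relabel-target p q with q ≟ q
... | yes _  = refl
... | no q≢q = ⊥-elim (q≢q refl)

relabel-fixes : ∀ {N} (p q : Fin N) → relabel p q p ≡ p
relabel-fixes p q with p ≟ q
... | yes _ = refl
... | no _  = refl

WalkWithin : ∀ {A : Set} (R : A → A → Set) → ℕ → A → A → Set
WalkWithin R m x y = Σ (Walk R x y) λ w → walkLength w ≤ m

Least : (ℕ → Set) → Set
Least P = Σ ℕ λ k → P k × (∀ {j} → P j → k ≤ j)

least : ∀ {P : ℕ → Set} → (∀ m → Dec (P m)) → ∀ {m} → P m → Least P
least {P} P? {m} = <-rec (λ m → P m → Least P) step m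
  where
  step : ∀ m → (∀ {k} → k ℕ.< m → P k → Least P) → P m → Least P
  step m smaller pm with ℕ.anyUpTo? P? m
  ... | yes (k , k<m , pk) = smaller k<m pk
  ... | no none            = m , pm , λ pj → ℕ.≮⇒≥ (λ j<m → none (_ , j<m , pj))

module _ {N : ℕ} {R : Fin N → Fin N → Set} (R? : ∀ a b → Dec (R a b)) where

  Connecting : (Fin N → Fin N) → Set
  Connecting ℓ = ∀ {x y} → ℓ x ≡ ℓ y → Walk (SymClosure R) x y

  merge-connecting : ∀ {ℓ a b} → Connecting ℓ → R a b → Connecting (relabel (ℓ a) (ℓ b) ∘ ℓ)
  merge-connecting {ℓ} {a} {b} connecting r {x} {y} ℓ′x≡ℓ′y with ℓ x ≟ ℓ b | ℓ y ≟ ℓ b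
  ... | yes x~b | yes y~b = connecting (trans x~b (sym y~b))
  ... | yes x~b | no _    = connecting x~b ++ʷ (inj₂ r ∷ connecting ℓ′x≡ℓ′y)
  ... | no _    | yes y~b = connecting ℓ′x≡ℓ′y ++ʷ (inj₁ r ∷ connecting (sym y~b))
  ... | no _    | no _    = connecting ℓ′x≡ℓ′y

  labelling : (L : List (Fin N × Fin N)) →
              Σ (Fin N → Fin N) λ ℓ → Connecting ℓ × (∀ {a b} → (a , b) ∈ L → R a b → ℓ a ≡ ℓ b)
  labelling [] = id , (λ { refl → [] }) , λ ()
  labelling ((a , b) ∷ L) with labelling L | R? a b
  ... | ℓ , connecting , respects | no ¬r = ℓ , connecting , respects′
    where
    respects′ : ∀ {x y} → (x , y) ∈ (a , b) ∷ L → R x y → ℓ x ≡ ℓ y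
    respects′ (here refl) r = ⊥-elim (¬r r)
    respects′ (there xy∈L)  = respects xy∈L
  ... | ℓ , connecting , respects | yes r = relabel (ℓ a) (ℓ b) ∘ ℓ , merge-connecting connecting r , respects′
    where
    respects′ : ∀ {x y} → (x , y) ∈ (a , b) ∷ L → R x y → relabel (ℓ a) (ℓ b) (ℓ x) ≡ relabel (ℓ a) (ℓ b) (ℓ y)
    respects′ (here refl) _   = trans (relabel-fixes (ℓ a) (ℓ b)) (sym (relabel-target (ℓ a) (ℓ b)))
    respects′ (there xy∈L) r′ = cong (relabel (ℓ a) (ℓ b)) (respects xy∈L r′)

  walk-or-cut : ∀ u v → Walk (SymClosure R) u v ⊎
                        (Σ (Fin N → Bool) λ T → T u ≡ true × T v ≡ false × (∀ {a b} → R a b → T a ≡ T b))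
  walk-or-cut u v with labelling (cartesianProduct (allFin N) (allFin N))
  ... | ℓ , connecting , respects with ℓ u ≟ ℓ v
  ...   | yes ℓu≡ℓv = inj₁ (connecting ℓu≡ℓv)
  ...   | no ℓu≢ℓv  = inj₂ (T , dec-true (ℓ u ≟ ℓ u) refl , dec-false (ℓ v ≟ ℓ u) (ℓu≢ℓv ∘ sym) , T-respects)
    where
    T : Fin N → Bool
    T x = does (ℓ x ≟ ℓ u)
    T-respects : ∀ {a b} → R a b → T a ≡ T b
    T-respects {a} {b} = cong (λ z → does (z ≟ ℓ u)) ∘ respects (∈-cartesianProduct⁺ (∈-allFin a) (∈-allFin b))

  walkWithin? : ∀ m x y → Dec (WalkWithin R m x y)
  walkWithin? m x y with x ≟ y
  ... | yes refl = yes ([] , z≤n)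
  walkWithin? zero    x y | no x≢y = no λ { ([] , _) → x≢y refl ; (_ ∷ _ , ()) }
  walkWithin? (suc m) x y | no x≢y with any? (λ z → R? x z ×-dec walkWithin? m z y)
  ... | yes (z , r , w , |w|≤m) = yes (r ∷ w , s≤s |w|≤m)
  ... | no none                 = no λ { ([] , _) → x≢y refl ; (r ∷ w , s≤s |w|≤m) → none (_ , r , w , |w|≤m) }

record SpanningTree {n : ℕ} (R : Fin (suc n) → Fin (suc n) → Set) : Set where
  field
    parent           : Fin n → Fin (suc n)
    parent-edge      : ∀ t → R (suc t) (parent t)
    depth            : Fin (suc n) → ℕ
    parent-shallower : ∀ t → depth (parent t) ℕ.< depth (suc t)

module _ {n : ℕ} {R : Fin (suc n) → Fin (suc n) → Set} (R? : ∀ a b → Dec (R a b))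
         (reach-root : ∀ k → Walk R k zero) where

  private
    shortest : ∀ k → Least (λ m → WalkWithin R m k zero)
    shortest k = least (λ m → walkWithin? R? m k zero) (reach-root k , ℕ.≤-refl)

    first-hop : ∀ t → Σ (Fin (suc n)) λ j → R (suc t) j ×
                  Σ (Walk R j zero) λ w → suc (walkLength w) ≤ proj₁ (shortest (suc t))
    first-hop t with proj₁ (proj₂ (shortest (suc t)))
    ... | r ∷ w , |w|<m = _ , r , w , |w|<m

  bfsTree : SpanningTree R
  bfsTree = record
    { parent           = proj₁ ∘ first-hop
    ; parent-edge      = proj₁ ∘ proj₂ ∘ first-hop
    ; depth            = proj₁ ∘ shortest
    ; parent-shallower = shallower
    }
    where
    shallower : ∀ t → proj₁ (shortest (proj₁ (first-hop t))) ℕ.< proj₁ (shortest (suc t))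
    shallower t with first-hop t
    ... | j , _ , w , |w|<m = ℕ.<-≤-trans (s≤s (proj₂ (proj₂ (shortest j)) (w , ℕ.≤-refl))) |w|<m

upper-bound : ∀ {n} (r : Fin n → ℕ) → ∃ λ B → ∀ t → r t ≤ B
upper-bound {zero}  r = 0 , λ ()
upper-bound {suc n} r with upper-bound (r ∘ suc)
... | B , r≤B = r zero ℕ.⊔ B , λ { zero → ℕ.m≤m⊔n (r zero) B ; (suc t) → ℕ.m≤n⇒m≤o⊔n (r zero) (r≤B t) }

descending-induction : ∀ {n} (r : Fin n → ℕ) (P : Fin n → Set) →
                       (∀ t → (∀ s → r t ℕ.< r s → P s) → P t) → ∀ t → P t
descending-induction r P step with upper-bound r
... | B , r≤B = All.wfRec (On.wellFounded (λ t → B ℕ.∸ r t) <-wellFounded) _ P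
                  (λ t deeper → step t (λ s rt<rs → deeper (ℕ.∸-monoʳ-< rt<rs (r≤B s))))

module _ {n : ℕ} {R : Fin (suc n) → Fin (suc n) → Set} (T : SpanningTree R) where
  open SpanningTree T

  -- Reading coordinate k of Σ μₜ (e_{t+1} − e_{parent t}) = 0 says that μ k is the
  -- sum of μ over the children of node suc k, which are deeper.
  treeEdges-linIndep : LinIndep (λ t → vtx (suc t) (parent t))
  treeEdges-linIndep μ μv≡0 = descending-induction (depth ∘ suc) (λ t → μ t ≡ 0ℚ) step
    where
    open ≡-Reasoning
    children : Fin n → ℚ
    children k = sumF (λ t → μ t · δ (parent t) (suc k))
    own : ∀ k → sumF (λ t → μ t · δ (suc t) (suc k)) ≡ μ k
    own k = trans (sumF-cong (λ t → cong (μ t ·_) (trans (δ-suc t k) (δ-sym t k)))) (sumF-select μ k)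
    flow : ∀ k → μ k ≡ children k
    flow k = x∙y⁻¹≈ε⇒x≈y (μ k) (children k) (begin
      μ k - children k                                                    ≡⟨ cong (_- children k) (sym (own k)) ⟩
      sumF (λ t → μ t · δ (suc t) (suc k)) - children k                   ≡⟨ sym (sumF-distrib-- (λ t → μ t · δ (suc t) (suc k)) _) ⟩
      sumF (λ t → μ t · δ (suc t) (suc k) - μ t · δ (parent t) (suc k))   ≡⟨ sumF-cong (λ t → sym (x[y-z]≈xy-xz (μ t) _ _)) ⟩
      lincomb μ (λ t → vtx (suc t) (parent t)) k                          ≡⟨ μv≡0 k ⟩
      0ℚ                                                                  ∎)
    step : ∀ t → (∀ s → depth (suc t) ℕ.< depth (suc s) → μ s ≡ 0ℚ) → μ t ≡ 0ℚ
    step t deeper≡0 = trans (flow t) (sumF-zero term≡0)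
      where
      term≡0 : ∀ s → μ s · δ (parent s) (suc t) ≡ 0ℚ
      term≡0 s with parent s ≟ suc t
      ... | yes ps≡t = trans (cong (_· 1ℚ) (deeper≡0 s t-shallower)) (ℚ.*-zeroˡ 1ℚ)
        where
        t-shallower : depth (suc t) ℕ.< depth (suc s)
        t-shallower = subst (λ x → depth x ℕ.< depth (suc s)) ps≡t (parent-shallower s)
      ... | no _     = ℚ.*-zeroʳ (μ s)

-- The adjacency polytope of a connected graph is full-dimensional: a spanning
-- tree gives n independent edge vectors, and one reversed tree edge completes
-- them to n + 1 affinely independent vertices.
edgeVectors-affIndep : ∀ {n} (G : SimpleGraph (suc (suc n))) → Connected G →
  Σ (Fin (suc (suc n)) → Fin (suc (suc n)) × Fin (suc (suc n))) λ f →
    (∀ t → Edge G (proj₁ (f t)) (proj₂ (f t))) × AffIndep (λ t → vtx (proj₁ (f t)) (proj₂ (f t)))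
edgeVectors-affIndep G connected = f , f-edge , negated-head-affIndep q (vtx-swap (suc zero) (parent zero)) (treeEdges-linIndep T)
  where
  T = bfsTree (edge? G) (λ k → connected k zero)
  open SpanningTree T
  f : Fin _ → Fin _ × Fin _
  f zero    = parent zero , suc zero
  f (suc t) = suc t , parent t
  f-edge : ∀ t → Edge G (proj₁ (f t)) (proj₂ (f t))
  f-edge zero    = edge-sym G (parent-edge zero)
  f-edge (suc t) = parent-edge t
  q : Fin _ → Fin _ → ℚ
  q t = vtx (proj₁ (f t)) (proj₂ (f t))

hasAffIndep-transpose : ∀ {n} (G : SimpleGraph (suc n)) {c c′ : Fin n → ℚ} {d k} →
                        (∀ i j → dot c′ (vtx i j) ≡ dot c (vtx j i)) →
                        HasAffIndep G c d k → HasAffIndep G c′ d k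
hasAffIndep-transpose G {c} {c′} {d} c′≡c-swapped (f , on-face , aff) =
  swap ∘ f , on-face′ , affIndep-neg (λ t → vtx-swap (proj₁ (f t)) (proj₂ (f t))) aff
  where
  on-face′ : ∀ t → OnFace G c′ d (proj₂ (f t)) (proj₁ (f t))
  on-face′ t = edge-sym G (proj₁ (on-face t)) , trans (c′≡c-swapped (proj₂ (f t)) (proj₁ (f t))) (proj₂ (on-face t))

module FacetSubnetwork {n : ℕ} (G : SimpleGraph (suc (suc n))) (connected : Connected G)
                       (c : Fin (suc n) → ℚ) (d : ℚ) (facet : IsFacet G c d) where

  private
    V = Fin (suc (suc n))
    h = potential c
    FE = FacetEdge G c d
    valid = proj₁ facet
    c⁻ : Fin (suc n) → ℚ
    c⁻ k = - c k

  telescope : ∀ x y z → h x - h z ≡ (h x - h y) + (h y - h z)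
  telescope x y z = solve 3 (λ a b c → a :- c := (a :- b) :+ (b :- c)) refl (h x) (h y) (h z)

  edge-drop-≤ : ∀ {a b} → Edge G a b → h a - h b ≤ℚ d
  edge-drop-≤ {a} {b} e = subst (_≤ℚ d) (dot-vtx c a b) (valid a b e)

  facetEdge-drop : ∀ {a b} → FE a b → h a - h b ≡ d
  facetEdge-drop {a} {b} (_ , on-face) = trans (sym (dot-vtx c a b)) on-face

  -- For d = 0 every edge lies on the face, which would then be all of ∇_G.
  offset≢0 : d ≢ 0ℚ
  offset≢0 d≡0 = proj₂ (proj₂ facet) (f , (λ t → f-edge t , on-face (f-edge t)) , aff)
    where
    full = edgeVectors-affIndep G connected
    f = proj₁ full
    f-edge = proj₁ (proj₂ full)
    aff = proj₂ (proj₂ full)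
    on-face : ∀ {a b} → Edge G a b → dot c (vtx a b) ≡ d
    on-face {a} {b} e = ℚ.≤-antisym (valid a b e) (subst (_≤ℚ dot c (vtx a b)) (sym d≡0) 0≤ab)
      where
      ba≤0 : dot c (vtx b a) ≤ℚ 0ℚ
      ba≤0 = subst (dot c (vtx b a) ≤ℚ_) d≡0 (valid b a (edge-sym G e))
      0≤ab : 0ℚ ≤ℚ dot c (vtx a b)
      0≤ab = subst (0ℚ ≤ℚ_) (sym (dot-vtx-swap c b a)) (ℚ.neg-antimono-≤ ba≤0)

  -d≤d : - d ≤ℚ d
  -d≤d with proj₁ (proj₂ facet)
  ... | f , on-face , _ = subst (_≤ℚ d) (trans (dot-vtx-swap c a b) (cong -_ (proj₂ (on-face zero))))
                                (valid b a (edge-sym G (proj₁ (on-face zero))))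
    where
    a = proj₁ (f zero)
    b = proj₂ (f zero)

  offset-pos : 0ℚ <ℚ d
  offset-pos with ℚ.<-cmp d 0ℚ
  ... | tri> _ _ 0<d = 0<d
  ... | tri≈ _ d≡0 _ = ⊥-elim (offset≢0 d≡0)
  ... | tri< d<0 _ _ = ⊥-elim (ℚ.<-irrefl refl (ℚ.≤-<-trans -d≤d (ℚ.<-trans d<0 (ℚ.neg-antimono-< d<0))))

  facetWalk-drop : ∀ {x y} (w : Walk FE x y) → h x - h y ≡ walkLength w ×ℚ d
  facetWalk-drop {x}     []                  = ℚ.+-inverseʳ (h x)
  facetWalk-drop {x} {y} (_∷_ {v = z} fe w) = trans (telescope x z y) (cong₂ _+_ (facetEdge-drop fe) (facetWalk-drop w))

  walk-drop-≤ : ∀ {x y} (w : Walk (Edge G) x y) → h x - h y ≤ℚ walkLength w ×ℚ d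
  walk-drop-≤ {x}     []                 = ℚ.≤-reflexive (ℚ.+-inverseʳ (h x))
  walk-drop-≤ {x} {y} (_∷_ {v = z} e w) =
    subst (_≤ℚ walkLength (e ∷ w) ×ℚ d) (sym (telescope x z y)) (ℚ.+-mono-≤ (edge-drop-≤ e) (walk-drop-≤ w))

  acyclic : ∀ u (w : Walk FE u u) → 1 ≤ walkLength w → ⊥
  acyclic u w 1≤|w| = ℕ.<⇒≱ 1≤|w| (×ℚ-cancelʳ-≤ (walkLength w) 0 offset-pos
    (ℚ.≤-reflexive (trans (sym (facetWalk-drop w)) (ℚ.+-inverseʳ (h u)))))

  walks-same-length : ∀ {u v} (p q : Walk FE u v) → walkLength p ≡ walkLength q
  walks-same-length p q = ℕ.≤-antisym (×ℚ-cancelʳ-≤ _ _ offset-pos (ℚ.≤-reflexive p≡q))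
                                      (×ℚ-cancelʳ-≤ _ _ offset-pos (ℚ.≤-reflexive (sym p≡q)))
    where
    p≡q : walkLength p ×ℚ d ≡ walkLength q ×ℚ d
    p≡q = trans (sym (facetWalk-drop p)) (facetWalk-drop q)

  -- The cycle splits at u and v into two arcs, each of which the potential drop
  -- h u − h v = m d along the facet walk cannot exceed.
  cycle-bound : ∀ {u v} (p : Walk FE u v) (C : Cycle G) → (∀ a b → (a , b) ∈ edges p → CycleEdge G C a b) →
                2 * walkLength p ≤ walkLength (Cycle.walk C)
  cycle-bound []            C on-C = z≤n
  cycle-bound {u} {v} p@(fe ∷ w) C on-C with closedWalk-arcs W (proj₁ (cycleEdge-verts (on-C u _ (here refl))))
                                                             (proj₂ (cycleEdge-verts (on-C _ v (proj₂ (last-edge fe w)))))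
    where
    W = Cycle.walk C
    cycleEdge-verts : ∀ {a b} → CycleEdge G C a b → a ∈ verts W × b ∈ verts W
    cycleEdge-verts (inj₁ ab∈W) = edge∈⇒verts∈ W ab∈W
    cycleEdge-verts (inj₂ ba∈W) = swap (edge∈⇒verts∈ W ba∈W)
  ... | A , B , |A|+|B| = subst (2 * m ≤_) |A|+|B| (×ℚ-cancelʳ-≤ (2 * m) _ offset-pos (begin
    (m ℕ.+ (m ℕ.+ 0)) ×ℚ d                 ≡⟨ ×-homo-+ d m (m ℕ.+ 0) ⟩
    m ×ℚ d + (m ℕ.+ 0) ×ℚ d                ≡⟨ cong (λ k → m ×ℚ d + k ×ℚ d) (ℕ.+-identityʳ m) ⟩
    m ×ℚ d + m ×ℚ d                        ≡⟨ cong₂ _+_ (sym (facetWalk-drop p)) (sym (facetWalk-drop p)) ⟩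
    (h u - h v) + (h u - h v)              ≤⟨ ℚ.+-mono-≤ (walk-drop-≤ A) B-bound ⟩
    walkLength A ×ℚ d + walkLength B ×ℚ d  ≡⟨ sym (×-homo-+ d (walkLength A) (walkLength B)) ⟩
    (walkLength A ℕ.+ walkLength B) ×ℚ d   ∎))
    where
    open ℚ.≤-Reasoning
    m = walkLength p
    B-bound : h u - h v ≤ℚ walkLength B ×ℚ d
    B-bound = subst (λ k → h u - h v ≤ℚ k ×ℚ d) (length-reverse (edge-sym G) B) (walk-drop-≤ (reverse (edge-sym G) B))

  negated-facet : IsFacet G c⁻ d × (∀ i j → FacetEdge G c⁻ d i j ⇔ FacetEdge G c d j i)
  negated-facet = (valid′ , hasAffIndep-transpose G {c} {c⁻} (dot-neg-vtx c) (proj₁ (proj₂ facet)) ,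
                   proj₂ (proj₂ facet) ∘ hasAffIndep-transpose G {c⁻} {c} (λ i j → sym (dot-neg-vtx c j i))) ,
                  λ i j → mk⇔ (λ (e , on) → edge-sym G e , trans (sym (dot-neg-vtx c i j)) on)
                              (λ (e , on) → edge-sym G e , trans (dot-neg-vtx c i j) on)
    where
    valid′ : Valid G c⁻ d
    valid′ i j e = subst (_≤ℚ d) (sym (dot-neg-vtx c i j)) (valid j i (edge-sym G e))

  -- The n affinely independent facet vertices span ℚⁿ (the facet misses the
  -- origin as d ≠ 0), so a potential constant across every edge of G_F is
  -- orthogonal to all of them.
  facet-potential-constant : (φ : V → ℚ) → (∀ {a b} → FE a b → φ a ≡ φ b) → ∀ i → φ i ≡ φ zero
  facet-potential-constant φ φ-const with proj₁ (proj₂ facet)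
  ... | f , on-face , aff = φ≡φ₀
    where
    q : Fin (suc n) → Fin (suc n) → ℚ
    q t = vtx (proj₁ (f t)) (proj₂ (f t))
    g : Fin (suc n) → ℚ
    g k = φ (suc k) - φ zero
    potential-g : ∀ i → potential g i ≡ φ i - φ zero
    potential-g zero    = sym (ℚ.+-inverseʳ (φ zero))
    potential-g (suc k) = refl
    g⊥q : ∀ t → dot g (q t) ≡ 0ℚ
    g⊥q t = begin
      dot g (q t)                          ≡⟨ dot-vtx g a b ⟩
      potential g a - potential g b        ≡⟨ cong₂ _-_ (potential-g a) (potential-g b) ⟩
      (φ a - φ zero) - (φ b - φ zero)      ≡⟨ cong (λ x → (x - φ zero) - (φ b - φ zero)) (φ-const (on-face t)) ⟩
      (φ b - φ zero) - (φ b - φ zero)      ≡⟨ ℚ.+-inverseʳ (φ b - φ zero) ⟩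
      0ℚ                                   ∎
      where
      open ≡-Reasoning
      a = proj₁ (f t)
      b = proj₂ (f t)
    q-indep : LinIndep q
    q-indep = affIndep⇒linIndep q c d offset≢0 (λ t → proj₂ (on-face t)) aff
    φ≡φ₀ : ∀ i → φ i ≡ φ zero
    φ≡φ₀ zero    = refl
    φ≡φ₀ (suc k) = x∙y⁻¹≈ε⇒x≈y (φ (suc k)) (φ zero) (orthogonal-to-independent⇒zero q q-indep g g⊥q k)

  facetEdge? : ∀ a b → Dec (FE a b)
  facetEdge? a b = edge? G a b ×-dec (dot c (vtx a b) ℚ.≟ d)

  weakly-connected : ∀ u v → Walk (SymClosure FE) u v
  weakly-connected u v with walk-or-cut facetEdge? u v
  ... | inj₁ walk                   = walk
  ... | inj₂ (T , Tu , Tv , T-const) = case 1ℚ≡0ℚ of λ ()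
    where
    indicator : Bool → ℚ
    indicator true  = 1ℚ
    indicator false = 0ℚ
    constant = facet-potential-constant (indicator ∘ T) (cong indicator ∘ T-const)
    1ℚ≡0ℚ : 1ℚ ≡ 0ℚ
    1ℚ≡0ℚ = begin
      1ℚ                 ≡⟨ cong indicator (sym Tu) ⟩
      indicator (T u)    ≡⟨ trans (constant u) (sym (constant v)) ⟩
      indicator (T v)    ≡⟨ cong indicator Tv ⟩
      0ℚ                 ∎
      where open ≡-Reasoning

  covers : ∀ i → InFacetNodes G c d i
  covers zero    = first-step (weakly-connected zero (suc zero)) λ ()
  covers (suc k) = first-step (weakly-connected (suc k) zero) λ ()

theorem1 : (n : ℕ) → 1 ≤ n → (G : SimpleGraph (suc n)) → Connected G →
    (c : Fin n → ℚ) (d : ℚ) → IsFacet G c d →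
      -- (i) acyclic: no directed closed walk of positive length
      (∀ (u : Fin (suc n)) (w : Walk (FacetEdge G c d) u u) → 1 ≤ walkLength w → ⊥)
      -- (ii) 𝓥_F is all nodes
      × (∀ i → InFacetNodes G c d i)
      -- (iii) weakly connected
      × (∀ u v → Walk (SymClosure (FacetEdge G c d)) u v)
      -- (iv) directed paths with same endpoints have the same length
      × (∀ u v (p q : Walk (FacetEdge G c d) u v) → IsPath p → IsPath q →
           walkLength p ≡ walkLength q)
      -- (v) a directed path lying on a cycle of length ℓ has length m with 2m ≤ ℓ
      × (∀ u v (p : Walk (FacetEdge G c d) u v) → IsPath p → (C : Cycle G) →
           (∀ a b → (a , b) ∈ edges p → CycleEdge G C a b) →
           2 * walkLength p ≤ walkLength (Cycle.walk C))
      -- (vi) -F (cut out by -c·x ≤ d) is a facet and G_(-F) is the transpose of G_F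
      × (IsFacet G (λ k → -ℚ c k) d
         × (∀ i j → FacetEdge G (λ k → -ℚ c k) d i j ⇔ FacetEdge G c d j i))
-- (iv) and (v) hold for all walks of G_F, not only for paths.
theorem1 (suc n) _ G connected c d facet =
  acyclic , covers , weakly-connected ,
  (λ u v p q _ _ → walks-same-length p q) ,
  (λ u v p _ → cycle-bound p) ,
  negated-facet
  where open FacetSubnetwork G connected c d facet
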